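{- Let $L=(L,\leq,(\sqsubseteq_\alpha)_{\alpha<\kappa})$ be a model. For each $\alpha<\kappa$ let $L|_\alpha=\{x|_\alpha : x\in L\}$, ordered by the restriction of $\leq$, and for $\beta<\alpha<\kappa$ define $h^\alpha_\beta: L|_\alpha\to L|_\beta$ by $h^\alpha_\beta(x)=x|_\beta$. Then each $L|_\alpha$ is a complete lattice, the maps $h^\alpha_\beta$ are locally completely additive projections forming an inverse system, and $L$ is isomorphic (as a stratified complete lattice) to the stratified complete lattice determined by the limit of this inverse system.
   Context: Fix a limit ordinal $\kappa$. A stratified complete lattice is $(L,\leq,(\sqsubseteq_\alpha)_{\alpha<\kappa})$ where $(L,\leq)$ is a complete lattice and each $\sqsubseteq_\alpha$ is a preorder on $L$; $x=_\alpha y$ means $x\sqsubseteq_\alpha y$ and $y\sqsubseteq_\alpha x$. Axioms: (A1) for $\alpha<\beta<\kappa$, $x\sqsubseteq_\beta y$ implies $x=_\alpha y$; (A2) if $x=_\alpha y$ for all $\alpha<\kappa$ then $x=y$; (A3) for all $x$ and $\alpha<\kappa$ there is $y$ with $x=_\alpha y$ such that for all $z$, $x\sqsubseteq_\alpha z$ implies $y\leq z$ (this $y$ is unique and is denoted $x|_\alpha$); (A4) for all $\alpha<\kappa$, nonempty $I$, and $x_i,y$ with $x_i=_\alpha y$ for all $i\in I$, $\bigvee_{i\in I}x_i=_\alpha y$; (A5) $x\leq y$ implies $x|_\alpha\leq y|_\alpha$; (A6) if $x\leq y$ and $x=_\beta y$ for all $\beta<\alpha$, then $x\sqsubseteq_\alpha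 y$. A model is a stratified complete lattice satisfying A1–A6. An isomorphism of stratified complete lattices is a bijection $f$ with $x\leq y\iff f(x)\leq f(y)$ and $x\sqsubseteq_\alpha y\iff f(x)\sqsubseteq_\alpha f(y)$ for all $\alpha$. For complete lattices $L,L'$, a monotone map $h:L'\to L$ is a projection if there is a monotone $k:L\to L'$ with $h\circ k=\mathrm{id}_L$ and $k(h(y))\leq y$ for all $y\in L'$; $h$ is locally completely additive if for every nonempty $Y\subseteq L'$ and $x\in L$ with $h(y)=x$ for all $y\in Y$, one has $h(\bigvee Y)=x$. An inverse system consists of complete lattices $L_\alpha$ ($\alpha<\kappa$) and projections $h^\alpha_\beta:L_\alpha\to L_\beta$ ($\beta<\alpha<\kappa$) with $h^\beta_\gamma\circ h^\alpha_\beta=h^\alpha_\gamma$ for $\gamma<\beta<\alpha$. Its limit $L_\infty$ is the set of sequences $(x_\alpha)_{\alpha<\kappa}\in\prod_\alpha L_\alpha$ with $h^\alpha_\beta(x_\alpha)=x_\beta$ for all $\beta<\alpha$, ordered pointwise (a complete lattice). The stratified complete lattice determined by the limit is $L_\infty$ with $x\sqsubseteq_\alpha y$ iff $x_\alpha\leq y_\alpha$ and $x_\beta=y_\beta$ for all $\beta<\alpha$. -}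

module Defs where

open import Level using (0ℓ)
open import Data.Product using (Σ; ∃; ∃-syntax; Σ-syntax; _×_; _,_; proj₁; proj₂)
open import Relation.Binary.Core using (Rel)
open import Relation.Binary.Bundles using (Poset)
open import Relation.Binary.Structures using (IsPreorder; IsStrictTotalOrder)
open import Relation.Binary.PropositionalEquality using (_≡_)
open import Induction.WellFounded using (WellFounded)
open import Function.Bundles using (_⇔_)
import Relation.Binary.Construct.On as On

-- A limit ordinal κ, presented as the well-ordered set of ordinals
-- below it: a nonempty well-order without a largest element.

record LimitOrdinal : Set₁ where
  field
    Ix                 : Set
    _<_                : Rel Ix 0ℓ
    isStrictTotalOrder : IsStrictTotalOrder _≡_ _<_
    wellFounded        : WellFounded _<_
    nonzero            : Ix
    noMax              : ∀ α → ∃[ β ] (α < β)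

module _ (P : Poset 0ℓ 0ℓ 0ℓ) where
  open Poset P

  IsSup : (Carrier → Set) → Carrier → Set
  IsSup S s = (∀ y → S y → y ≤ s) × (∀ u → (∀ y → S y → y ≤ u) → s ≤ u)

  IsCompleteLattice : Set₁
  IsCompleteLattice = ∀ (S : Carrier → Set) → ∃[ s ] IsSup S s

  Image : {I : Set} → (I → Carrier) → Carrier → Set
  Image x z = ∃[ i ] (z ≈ x i)

  Nonempty : (Carrier → Set) → Set
  Nonempty S = ∃[ y ] S y

Monotone : (A B : Poset 0ℓ 0ℓ 0ℓ) → (Poset.Carrier A → Poset.Carrier B) → Set
Monotone A B f = ∀ {x y} → Poset._≤_ A x y → Poset._≤_ B (f x) (f y)

IsProjection : (A B : Poset 0ℓ 0ℓ 0ℓ) → (Poset.Carrier A → Poset.Carrier B) → Set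
IsProjection A B h =
  Monotone A B h ×
  (Σ[ k ∈ (Poset.Carrier B → Poset.Carrier A) ]
     (Monotone B A k
      × (∀ x → Poset._≈_ B (h (k x)) x)
      × (∀ y → Poset._≤_ A (k (h y)) y)))

LocallyCompletelyAdditive : (A B : Poset 0ℓ 0ℓ 0ℓ) → (Poset.Carrier A → Poset.Carrier B) → Set₁
LocallyCompletelyAdditive A B h =
  ∀ (Y : Poset.Carrier A → Set) → Nonempty A Y →
  ∀ (x : Poset.Carrier B) → (∀ y → Y y → Poset._≈_ B (h y) x) →
  ∀ (s : Poset.Carrier A) → IsSup A Y s → Poset._≈_ B (h s) x

record StratifiedCompleteLattice (κ : LimitOrdinal) : Set₁ where
  open LimitOrdinal κ
  field
    poset       : Poset 0ℓ 0ℓ 0ℓ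
  open Poset poset public
  field
    complete    : IsCompleteLattice poset
    _⊑[_]_      : Carrier → Ix → Carrier → Set
    ⊑-preorder  : ∀ α → IsPreorder _≈_ (λ x y → x ⊑[ α ] y)

  _=[_]_ : Carrier → Ix → Carrier → Set
  x =[ α ] y = (x ⊑[ α ] y) × (y ⊑[ α ] x)

record IsModel {κ : LimitOrdinal} (L : StratifiedCompleteLattice κ) : Set₁ where
  open LimitOrdinal κ
  open StratifiedCompleteLattice L
  field
    A1 : ∀ {α β x y} → α < β → x ⊑[ β ] y → x =[ α ] y
    A2 : ∀ {x y} → (∀ α → x =[ α ] y) → x ≈ y
    A3 : ∀ x α → Σ[ y ∈ Carrier ] ((x =[ α ] y) × (∀ z → x ⊑[ α ] z → y ≤ z))
    A4 : ∀ α {I : Set} → I → (x : I → Carrier) → (y : Carrier) →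
         (∀ i → x i =[ α ] y) →
         ∀ s → IsSup poset (Image poset x) s → s =[ α ] y
    A5 : ∀ {x y} α → x ≤ y → proj₁ (A3 x α) ≤ proj₁ (A3 y α)
    A6 : ∀ {α x y} → x ≤ y → (∀ β → β < α → x =[ β ] y) → x ⊑[ α ] y

record Model (κ : LimitOrdinal) : Set₁ where
  field
    scl     : StratifiedCompleteLattice κ
    isModel : IsModel scl
  open StratifiedCompleteLattice scl public
  open IsModel isModel public

  _∣_ : Carrier → LimitOrdinal.Ix κ → Carrier
  x ∣ α = proj₁ (A3 x α)

module ModelSystem {κ : LimitOrdinal} (M : Model κ) where
  open LimitOrdinal κ
  open Model M

  Restr : Ix → Set
  Restr α = Σ[ y ∈ Carrier ] ∃[ x ] (y ≈ (x ∣ α))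

  L∣ : Ix → Poset 0ℓ 0ℓ 0ℓ
  L∣ α = On.poset poset (proj₁ {B = λ (y : Carrier) → ∃[ x ] (y ≈ (x ∣ α))})

  h : (α β : Ix) → Restr α → Restr β
  h α β (y , _) = (y ∣ β) , (y , Poset.Eq.refl poset)

  L∞ : Set
  L∞ = Σ[ f ∈ ((α : Ix) → Restr α) ]
         (∀ α β → β < α → Poset._≈_ (L∣ β) (h α β (f α)) (f β))

  _≈∞_ : L∞ → L∞ → Set
  x ≈∞ y = ∀ α → Poset._≈_ (L∣ α) (proj₁ x α) (proj₁ y α)

  _≤∞_ : L∞ → L∞ → Set
  x ≤∞ y = ∀ α → Poset._≤_ (L∣ α) (proj₁ x α) (proj₁ y α)

  _⊑∞[_]_ : L∞ → Ix → L∞ → Set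
  x ⊑∞[ α ] y = Poset._≤_ (L∣ α) (proj₁ x α) (proj₁ y α)
              × (∀ β → β < α → Poset._≈_ (L∣ β) (proj₁ x β) (proj₁ y β))

  IsStratIso : (Carrier → L∞) → Set
  IsStratIso F =
      (∀ {x y} → x ≈ y → F x ≈∞ F y)
    × (∀ {x y} → F x ≈∞ F y → x ≈ y)
    × (∀ z → ∃[ x ] (F x ≈∞ z))
    × (∀ x y → (x ≤ y) ⇔ (F x ≤∞ F y))
    × (∀ α x y → (x ⊑[ α ] y) ⇔ (F x ⊑∞[ α ] F y))

module Submission where

-- Write x|α for the restriction of A3 and call y "fixed at α"
-- when y ≈ y|α; the carrier of L|α consists exactly of such elements.
-- General facts about an arbitrary model come first: x =α y iff
-- x|α ≈ y|α, restrictions compose (x|α)|β ≈ x|β for β < α, elements are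
-- separated by their restrictions (A2), being fixed at β implies being
-- fixed at every α > β, and a supremum of elements fixed at α is fixed
-- at α (A5).  Hence L|α is closed under suprema of L (complete lattice),
-- the inclusion L|β ⊆ L|α is a section of h^α_β (projection), and A4
-- yields local complete additivity.  For the isomorphism F x = (x|α)_α,
-- the key lemma is that a compatible family z is recovered from its join:
-- (⋁ z)|α ≈ z_α.  This follows from A4 applied to the cofinal family
-- β ↦ z_(max α β), all of whose members agree with z_α up to =α.  Order
-- reflection, surjectivity and the stratification then follow from this
-- lemma, separation and A1/A6.

open import Level using (0ℓ)
open import Defs
open import Data.Product using (Σ; ∃-syntax; Σ-syntax; _×_; _,_; proj₁; proj₂)
open import Data.Sum using (_⊎_; inj₁; inj₂)
open import Relation.Binary.Bundles using (Poset)
open import Relation.Binary.Structures using (IsPreorder; IsStrictTotalOrder)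
open import Relation.Binary.Definitions using (tri<; tri≈; tri>)
open import Relation.Binary.PropositionalEquality using (_≡_; refl)
open import Function.Bundles using (mk⇔)

module Suprema (P : Poset 0ℓ 0ℓ 0ℓ) where
  open Poset P

  sup-unique : ∀ {S s t} → IsSup P S s → IsSup P S t → s ≈ t
  sup-unique (s-ub , s-least) (t-ub , t-least) =
    antisym (s-least _ t-ub) (t-least _ s-ub)

  sup-dominated : ∀ {I : Set} {f g : I → Carrier} {s} →
                  (∀ i → f i ≤ g i) → (∀ i → ∃[ j ] (g i ≈ f j)) →
                  IsSup P (Image P f) s → IsSup P (Image P g) s
  sup-dominated {f = f} {g} f≤g g∈f (ub , least) =
      (λ { y (i , y≈gi) → let (j , gi≈fj) = g∈f i in
             trans (reflexive (Eq.trans y≈gi gi≈fj)) (ub (f j) (j , Eq.refl)) })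
    , (λ u g≤u → least u (λ { y (i , y≈fi) →
             trans (reflexive y≈fi) (trans (f≤g i) (g≤u (g i) (i , Eq.refl))) }))

module Indices (κ : LimitOrdinal) where
  open LimitOrdinal κ
  open IsStrictTotalOrder isStrictTotalOrder using (compare)

  _≼_ : Ix → Ix → Set
  α ≼ β = α < β ⊎ α ≡ β

  max : Ix → Ix → Ix
  max α β with compare α β
  ... | tri< _ _ _ = β
  ... | tri≈ _ _ _ = β
  ... | tri> _ _ _ = α

  ≼-maxˡ : ∀ α β → α ≼ max α β
  ≼-maxˡ α β with compare α β
  ... | tri< α<β _ _ = inj₁ α<β
  ... | tri≈ _ α≡β _ = inj₂ α≡β
  ... | tri> _ _ _   = inj₂ refl

  ≼-maxʳ : ∀ α β → β ≼ max α β
  ≼-maxʳ α β with compare α β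
  ... | tri< _ _ _   = inj₂ refl
  ... | tri≈ _ _ _   = inj₂ refl
  ... | tri> _ _ β<α = inj₁ β<α

module ModelFacts {κ : LimitOrdinal} (M : Model κ) where
  open LimitOrdinal κ
  open Model M

  ⊑-reflexive : ∀ {α x y} → x ≈ y → x ⊑[ α ] y
  ⊑-reflexive {α} = IsPreorder.reflexive (⊑-preorder α)

  ⊑-trans : ∀ {α x y z} → x ⊑[ α ] y → y ⊑[ α ] z → x ⊑[ α ] z
  ⊑-trans {α} = IsPreorder.trans (⊑-preorder α)

  ≈⇒= : ∀ {α x y} → x ≈ y → x =[ α ] y
  ≈⇒= x≈y = ⊑-reflexive x≈y , ⊑-reflexive (Eq.sym x≈y)

  =-sym : ∀ {α x y} → x =[ α ] y → y =[ α ] x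
  =-sym (x⊑y , y⊑x) = y⊑x , x⊑y

  =-trans : ∀ {α x y z} → x =[ α ] y → y =[ α ] z → x =[ α ] z
  =-trans (x⊑y , y⊑x) (y⊑z , z⊑y) = ⊑-trans x⊑y y⊑z , ⊑-trans z⊑y y⊑x

  ∣-equal : ∀ x α → x =[ α ] (x ∣ α)
  ∣-equal x α = proj₁ (proj₂ (A3 x α))

  ∣-least : ∀ x α z → x ⊑[ α ] z → (x ∣ α) ≤ z
  ∣-least x α = proj₂ (proj₂ (A3 x α))

  ∣-below : ∀ x α → (x ∣ α) ≤ x
  ∣-below x α = ∣-least x α x (⊑-reflexive Eq.refl)

  =⇒∣≈ : ∀ {x y α} → x =[ α ] y → (x ∣ α) ≈ (y ∣ α)
  =⇒∣≈ {x} {y} {α} (x⊑y , y⊑x) =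
    antisym (∣-least x α (y ∣ α) (⊑-trans x⊑y (proj₁ (∣-equal y α))))
            (∣-least y α (x ∣ α) (⊑-trans y⊑x (proj₁ (∣-equal x α))))

  ∣≈⇒= : ∀ {x y α} → (x ∣ α) ≈ (y ∣ α) → x =[ α ] y
  ∣≈⇒= {x} {y} {α} e = =-trans (∣-equal x α) (=-trans (≈⇒= e) (=-sym (∣-equal y α)))

  ∣-cong : ∀ {x y α} → x ≈ y → (x ∣ α) ≈ (y ∣ α)
  ∣-cong x≈y = =⇒∣≈ (≈⇒= x≈y)

  ∣-idem : ∀ x α → ((x ∣ α) ∣ α) ≈ (x ∣ α)
  ∣-idem x α = =⇒∣≈ (=-sym (∣-equal x α))

  ∣-∣ : ∀ {x α β} → β < α → ((x ∣ α) ∣ β) ≈ (x ∣ β)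
  ∣-∣ {x} {α} β<α = =⇒∣≈ (A1 β<α (proj₂ (∣-equal x α)))

  separate : ∀ {x y} → (∀ α → (x ∣ α) ≈ (y ∣ α)) → x ≈ y
  separate e = A2 (λ α → ∣≈⇒= (e α))

  Fixed : Ix → Carrier → Set
  Fixed α y = y ≈ (y ∣ α)

  restricted-fixed : ∀ {y x α} → y ≈ (x ∣ α) → Fixed α y
  restricted-fixed {y} {x} {α} y≈x∣α =
    Eq.trans y≈x∣α (Eq.trans (Eq.sym (∣-idem x α)) (Eq.sym (∣-cong y≈x∣α)))

  fixed-up : ∀ {y α β} → β < α → Fixed β y → Fixed α y
  fixed-up {y} {α} β<α y-fixed =
    antisym (trans (reflexive (Eq.trans y-fixed (Eq.sym (∣-∣ β<α))))
                   (∣-below (y ∣ α) _))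
            (∣-below y α)

  sup-fixed : ∀ {S s α} → IsSup poset S s → (∀ y → S y → Fixed α y) → Fixed α s
  sup-fixed {s = s} {α} (ub , least) all-fixed =
    antisym (least (s ∣ α) (λ y Sy → trans (reflexive (all-fixed y Sy)) (A5 α (ub y Sy))))
            (∣-below s α)

module SystemFacts {κ : LimitOrdinal} (M : Model κ) where
  open LimitOrdinal κ
  open Model M
  open ModelSystem M
  open ModelFacts M
  open Indices κ
  open Suprema poset using (sup-dominated)

  restr-fixed : ∀ {α} (r : Restr α) → Fixed α (proj₁ r)
  restr-fixed (_ , _ , y≈x∣α) = restricted-fixed y≈x∣α

  Members : ∀ {α} → (Restr α → Set) → Carrier → Set
  Members {α} S = Image poset (λ (i : Σ (Restr α) S) → proj₁ (proj₁ i))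

  ⋁∣ : ∀ {α} → (Restr α → Set) → Carrier
  ⋁∣ S = proj₁ (complete (Members S))

  ⋁∣-in : ∀ {α} (S : Restr α → Set) → Restr α
  ⋁∣-in S = ⋁∣ S , ⋁∣ S ,
    sup-fixed (proj₂ (complete (Members S))) (λ { y (i , y≈i) → restricted-fixed
                                                    (Eq.trans y≈i (proj₂ (proj₂ (proj₁ i)))) })

  ⋁∣-isSup : ∀ {α} (S : Restr α → Set) → IsSup (L∣ α) S (⋁∣-in S)
  ⋁∣-isSup S =
      (λ r Sr → ub (proj₁ r) ((r , Sr) , Eq.refl))
    , (λ u u-ub → least (proj₁ u) (λ { y ((r , Sr) , y≈r) → trans (reflexive y≈r) (u-ub r Sr) }))
    where
    ub    = proj₁ (proj₂ (complete (Members S)))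
    least = proj₂ (proj₂ (complete (Members S)))

  complete∣ : ∀ α → IsCompleteLattice (L∣ α)
  complete∣ α S = ⋁∣-in S , ⋁∣-isSup S

  -- h^α_β has the inclusion L|β ⊆ L|α as lower section.
  projection : ∀ α β → β < α → IsProjection (L∣ α) (L∣ β) (h α β)
  projection α β β<α =
      A5 β , include , (λ y≤y' → y≤y')
    , (λ r → Eq.sym (restr-fixed r)) , (λ r → ∣-below (proj₁ r) β)
    where
    include : Restr β → Restr α
    include r = proj₁ r , proj₁ r , fixed-up β<α (restr-fixed r)

  additive : ∀ α β → β < α → LocallyCompletelyAdditive (L∣ α) (L∣ β) (h α β)
  additive α β β<α Y (y₀ , Yy₀) x h≈x s s-sup = begin
      proj₁ s ∣ β       ≈⟨ ∣-cong s≈⋁Y ⟩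
      ⋁∣ Y ∣ β          ≈⟨ =⇒∣≈ ⋁Y=x ⟩
      proj₁ x ∣ β       ≈⟨ Eq.sym (restr-fixed x) ⟩
      proj₁ x           ∎
    where
    open import Relation.Binary.Reasoning.Setoid Eq.setoid
    s≈⋁Y : proj₁ s ≈ ⋁∣ Y
    s≈⋁Y = Suprema.sup-unique (L∣ α) {S = Y} {s} {⋁∣-in Y} s-sup (⋁∣-isSup Y)
    ⋁Y=x : ⋁∣ Y =[ β ] proj₁ x
    ⋁Y=x = A4 β (y₀ , Yy₀) (λ i → proj₁ (proj₁ i)) (proj₁ x)
              (λ { (r , Yr) → =-trans (∣-equal (proj₁ r) β) (≈⇒= (h≈x r Yr)) })
              (⋁∣ Y) (proj₂ (complete (Members Y)))

  F : Carrier → L∞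
  F x = (λ α → (x ∣ α) , x , Eq.refl) , (λ α β β<α → ∣-∣ β<α)

  at : L∞ → Ix → Carrier
  at z α = proj₁ (proj₁ z α)

  at-mono : ∀ z {β γ} → β ≼ γ → at z β ≤ at z γ
  at-mono z {β} {γ} (inj₁ β<γ) = trans (reflexive (Eq.sym (proj₂ z γ β β<γ))) (∣-below (at z γ) β)
  at-mono z (inj₂ refl) = reflexive Eq.refl

  at-agree : ∀ z {β γ} → β ≼ γ → at z γ =[ β ] at z β
  at-agree z {β} {γ} (inj₁ β<γ) = =-trans (∣-equal (at z γ) β) (≈⇒= (proj₂ z γ β β<γ))
  at-agree z (inj₂ refl) = ≈⇒= Eq.refl

  ⋁ : L∞ → Carrier
  ⋁ z = proj₁ (complete (Image poset (at z)))

  ⋁-isSup : ∀ z → IsSup poset (Image poset (at z)) (⋁ z)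
  ⋁-isSup z = proj₂ (complete (Image poset (at z)))

  ⋁-restrict : ∀ z α → (⋁ z ∣ α) ≈ at z α
  ⋁-restrict z α =
    Eq.trans (=⇒∣≈ ⋁z=zα) (Eq.sym (restr-fixed (proj₁ z α)))
    where
    tail-sup : IsSup poset (Image poset (λ β → at z (max α β))) (⋁ z)
    tail-sup = sup-dominated (λ β → at-mono z (≼-maxʳ α β))
                             (λ β → max α β , Eq.refl) (⋁-isSup z)
    ⋁z=zα : ⋁ z =[ α ] at z α
    ⋁z=zα = A4 α α (λ β → at z (max α β)) (at z α)
               (λ β → at-agree z (≼-maxˡ α β)) (⋁ z) tail-sup

  ≈-⋁F : ∀ x → x ≈ ⋁ (F x)
  ≈-⋁F x = separate (λ α → Eq.sym (⋁-restrict (F x) α))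

  F-reflects-≤ : ∀ x y → F x ≤∞ F y → x ≤ y
  F-reflects-≤ x y x∣≤y∣ =
    trans (reflexive (≈-⋁F x))
          (proj₂ (⋁-isSup (F x)) y (λ { w (β , w≈x∣β) →
             trans (reflexive w≈x∣β) (trans (x∣≤y∣ β) (∣-below y β)) }))

  F-preserves-⊑ : ∀ α x y → x ⊑[ α ] y → F x ⊑∞[ α ] F y
  F-preserves-⊑ α x y x⊑y =
      ∣-least x α (y ∣ α) (⊑-trans x⊑y (proj₁ (∣-equal y α)))
    , (λ β β<α → =⇒∣≈ (A1 β<α x⊑y))

  -- Conversely, A6 applied to x|α ≤ y|α gives x|α ⊑α y|α.
  F-reflects-⊑ : ∀ α x y → F x ⊑∞[ α ] F y → x ⊑[ α ] y
  F-reflects-⊑ α x y (x∣≤y∣ , below) =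
    ⊑-trans (proj₁ (∣-equal x α)) (⊑-trans x∣⊑y∣ (proj₂ (∣-equal y α)))
    where
    agree-below : ∀ β → β < α → (x ∣ α) =[ β ] (y ∣ α)
    agree-below β β<α =
      ∣≈⇒= (Eq.trans (∣-∣ β<α) (Eq.trans (below β β<α) (Eq.sym (∣-∣ β<α))))
    x∣⊑y∣ : (x ∣ α) ⊑[ α ] (y ∣ α)
    x∣⊑y∣ = A6 x∣≤y∣ agree-below

  F-iso : IsStratIso F
  F-iso = (λ x≈y α → ∣-cong x≈y)
        , separate
        , (λ z → ⋁ z , ⋁-restrict z)
        , (λ x y → mk⇔ (λ x≤y α → A5 α x≤y) (F-reflects-≤ x y))
        , (λ α x y → mk⇔ (F-preserves-⊑ α x y) (F-reflects-⊑ α x y))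

theorem2 : (κ : LimitOrdinal) (M : Model κ) →
    let open LimitOrdinal κ
        open ModelSystem M
    in (∀ α → IsCompleteLattice (L∣ α))
       × (∀ α β → β < α →
            IsProjection (L∣ α) (L∣ β) (h α β)
            × LocallyCompletelyAdditive (L∣ α) (L∣ β) (h α β))
       × (∀ α β γ → γ < β → β < α → ∀ x →
            Poset._≈_ (L∣ γ) (h β γ (h α β x)) (h α γ x))
       × (Σ[ F ∈ (Model.Carrier M → L∞) ] IsStratIso F)
theorem2 κ M =
    complete∣
  , (λ α β β<α → projection α β β<α , additive α β β<α)
  , (λ α β γ γ<β β<α x → ∣-∣ γ<β)
  , F , F-iso
  where
  open ModelFacts M using (∣-∣)
  open SystemFacts M
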